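{- The skew $\sim$-operation maps: (i) pairs of horizontal strips to pairs of horizontal strips; (ii) pairs of vertical strips to pairs of vertical strips; (iii) pairs of weak ribbons to pairs of weak ribbons; (iv) pairs of skewed hooks to pairs of skewed hooks. That is, if $(\mu/\alpha,\nu/\beta)$ is a pair of skew shapes both of one of these types, then so is $(\mu/\alpha,\nu/\beta)^\sim$.
   Context: A skew shape $\mu/\alpha$ is given by a pair of partitions $\alpha\subseteq\mu$ (the specific pair matters, not just the set of cells). For partitions $\mu,\nu$, $(\mu,\nu)^\sim=(\lambda,\rho)$ is defined by letting $\gamma_1\ge\cdots\ge\gamma_{2p}\ge0$ be the decreasing rearrangement of all parts of $\mu$ and $\nu$ (padded with zeros) and setting $\lambda=(\gamma_1,\gamma_3,\ldots)$, $\rho=(\gamma_2,\gamma_4,\ldots)$; equivalently, in terms of conjugates, $\lambda'_i=\lceil(\mu'_i+\nu'_i)/2\rceil$ and $\rho'_i=\lfloor(\mu'_i+\nu'_i)/2\rfloor$ for all $i$. For skew shapes, $(\mu/\alpha,\nu/\beta)^\sim:=(\lambda/\sigma,\rho/\tau)$ where $(\lambda,\rho)=(\mu,\nu)^\sim$ and $(\sigma,\tau)=(\alpha,\beta)^\sim$ (one has $\sigma\subseteq\lambda$, $\tau\subseteq\rho$). A horizontal strip is a skew shape with at most one cell in each column; a vertical strip has at most one cell in each row; a weak ribbon is a skew shape whose diagram contains no $2\times2$ block of cells; a skewed hook is a skew shape $\mu/\alpha$ with $\mu$ and $\alpha$ both non-empty hooks (partitions of the form $(j,1^k)$). -}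

module Defs where

open import Data.Nat using (ℕ; zero; suc; _≤_; _<_; _≥_; _≤ᵇ_)
open import Data.Bool using (if_then_else_)
open import Data.List using (List; []; _∷_; replicate)
open import Data.List.Relation.Unary.All using (All)
open import Data.List.Relation.Unary.Linked using (Linked)
open import Data.Product using (_×_; _,_; proj₁; proj₂; Σ; ∃₂)
open import Relation.Binary.PropositionalEquality using (_≡_)
open import Relation.Nullary using (¬_)

-- A partition is a weakly decreasing list of positive naturals
-- (parts λ₁ ≥ λ₂ ≥ … > 0; the implicit trailing zeros are omitted).
IsPartition : List ℕ → Set
IsPartition p = Linked _≥_ p × All (λ x → 0 < x) p

-- i-th part (0-indexed), padded with zeros.
part : List ℕ → ℕ → ℕ
part []       _       = 0
part (x ∷ xs) zero    = x
part (x ∷ xs) (suc i) = part xs i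

_⊆ᵖ_ : List ℕ → List ℕ → Set
α ⊆ᵖ μ = ∀ i → part α i ≤ part μ i

-- Cell (i , j) (row i, column j, 0-indexed) lies in the skew diagram μ/α.
InSkew : List ℕ → List ℕ → ℕ → ℕ → Set
InSkew μ α i j = part α i ≤ j × j < part μ i

-- Decreasing rearrangement (merge of two weakly decreasing lists).
merge : List ℕ → List ℕ → List ℕ
merge []       ys       = ys
merge (x ∷ xs) []       = x ∷ xs
merge (x ∷ xs) (y ∷ ys) =
  if y ≤ᵇ x then x ∷ merge xs (y ∷ ys) else y ∷ merge (x ∷ xs) ys

split : List ℕ → List ℕ × List ℕ
split []       = [] , []
split (x ∷ xs) = x ∷ proj₂ (split xs) , proj₁ (split xs)

tilde : List ℕ → List ℕ → List ℕ × List ℕ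
tilde μ ν = split (merge μ ν)

-- Skew shape types. A skew shape μ/α is the pair (μ , α) with α ⊆ μ.
IsHorizontalStrip : List ℕ → List ℕ → Set
IsHorizontalStrip μ α =
  α ⊆ᵖ μ × (∀ i i' j → i < i' → ¬ (InSkew μ α i j × InSkew μ α i' j))

IsVerticalStrip : List ℕ → List ℕ → Set
IsVerticalStrip μ α =
  α ⊆ᵖ μ × (∀ i j j' → j < j' → ¬ (InSkew μ α i j × InSkew μ α i j'))

IsWeakRibbon : List ℕ → List ℕ → Set
IsWeakRibbon μ α =
  α ⊆ᵖ μ × (∀ i j → ¬ (InSkew μ α i j × InSkew μ α (suc i) j
                      × InSkew μ α i (suc j) × InSkew μ α (suc i) (suc j)))

IsHook : List ℕ → Set
IsHook p = ∃₂ λ j k → 1 ≤ j × p ≡ j ∷ replicate k 1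

IsSkewedHook : List ℕ → List ℕ → Set
IsSkewedHook μ α = α ⊆ᵖ μ × IsHook μ × IsHook α

PreservedByTilde : (List ℕ → List ℕ → Set) → Set
PreservedByTilde P =
  ∀ μ α ν β →
  IsPartition μ → IsPartition α → IsPartition ν → IsPartition β →
  P μ α → P ν β →
  P (proj₁ (tilde μ ν)) (proj₁ (tilde α β)) ×
  P (proj₂ (tilde μ ν)) (proj₂ (tilde α β))

{-# OPTIONS --safe #-}
module Submission where

-- On conjugates the ∼-operation reads λ′ = ⌈(μ′ + ν′)/2⌉, ρ′ = ⌊(μ′ + ν′)/2⌋. For decreasing
-- lists the row inequalities μ_(s+i) ≤ c + α_i (all i) are equivalent to the column
-- inequalities μ′_(c+j) ≤ s + α′_j (all j). Merging adds conjugates, so the column inequalities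
-- for (μ, α) and (ν, β) add up to the ones with row shift 2s for the merged lists, and taking
-- every other row halves that shift back to s. Containment, horizontal strips, vertical strips
-- and weak ribbons are exactly the row inequalities with (s, c) = (0, 0), (1, 0), (0, 1), (1, 1);
-- for hooks the ∼-operation is computed directly.

open import Defs
open import Data.Bool using (true; false; if_then_else_)
open import Data.List using (List; []; _∷_; replicate; length; filter; _++_)
import Data.List as List
open import Data.List.Properties using (length-++; filter-++; filter-accept; filter-reject)
open import Data.List.Relation.Binary.Permutation.Propositional.Properties
  using (merge-↭; filter-↭; ↭-length)
open import Data.List.Relation.Unary.Linked using (Linked; [-]; _∷_)
import Data.List.Relation.Unary.Linked as Linked
open import Data.List.Relation.Unary.Sorted.TotalOrder.Properties using (merge⁺)
open import Data.Nat using (ℕ; zero; suc; _+_; _≤_; _<_; _≥_; _≤ᵇ_; z≤n; s≤s)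
open import Data.Nat.Properties
open import Algebra.Properties.CommutativeSemigroup +-commutativeSemigroup using (interchange)
open import Data.Product using (_×_; _,_; proj₁; proj₂; ∃₂)
open import Function using (_∘_)
open import Function.Bundles using (_⇔_; mk⇔; Equivalence)
open import Relation.Binary.Construct.Flip.EqAndOrd using (decTotalOrder)
open import Relation.Binary.Core using (_Preserves_⟶_)
open import Relation.Binary.PropositionalEquality
open import Relation.Nullary using (¬_; yes; no; contradiction)

Decreasing : List ℕ → Set
Decreasing = Linked _≥_

part-≤-head : ∀ {x xs} → Decreasing (x ∷ xs) → ∀ i → part (x ∷ xs) i ≤ x
part-≤-head d zero = ≤-refl
part-≤-head [-] (suc i) = z≤n
part-≤-head (x≥y ∷ d) (suc i) = ≤-trans (part-≤-head d i) x≥y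

part-antitone : ∀ {L} → Decreasing L → part L Preserves _≤_ ⟶ _≥_
part-antitone {[]} d _ = z≤n
part-antitone {x ∷ xs} d {zero} {j} _ = part-≤-head d j
part-antitone {x ∷ xs} d {suc i} {suc j} (s≤s i≤j) = part-antitone (Linked.tail d) i≤j

merge-≡-List-merge : ∀ μ ν → merge μ ν ≡ List.merge _≥?_ μ ν
merge-≡-List-merge [] ν = refl
merge-≡-List-merge (x ∷ xs) [] = refl
merge-≡-List-merge (x ∷ xs) (y ∷ ys) =
  cong₂ (if y ≤ᵇ x then_else_)
        (cong (x ∷_) (merge-≡-List-merge xs (y ∷ ys)))
        (cong (y ∷_) (merge-≡-List-merge (x ∷ xs) ys))

merge-decreasing : ∀ {μ ν} → Decreasing μ → Decreasing ν → Decreasing (merge μ ν)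
merge-decreasing {μ} {ν} dμ dν =
  subst Decreasing (sym (merge-≡-List-merge μ ν)) (merge⁺ (decTotalOrder ≤-decTotalOrder) dμ dν)

-- column L j = L′_(j+1), the number of parts of L exceeding j.
column : List ℕ → ℕ → ℕ
column L j = length (filter (j <?_) L)

column-merge : ∀ μ ν j → column (merge μ ν) j ≡ column μ j + column ν j
column-merge μ ν j = begin
  length (filter P? (merge μ ν))           ≡⟨ cong (length ∘ filter P?) (merge-≡-List-merge μ ν) ⟩
  length (filter P? (List.merge _≥?_ μ ν)) ≡⟨ ↭-length (filter-↭ P? (merge-↭ _≥?_ μ ν)) ⟩
  length (filter P? (μ ++ ν))              ≡⟨ cong length (filter-++ P? μ ν) ⟩
  length (filter P? μ ++ filter P? ν)      ≡⟨ length-++ (filter P? μ) ⟩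
  column μ j + column ν j                  ∎
  where
  open ≡-Reasoning
  P? = j <?_

column-∷-> : ∀ {x xs j} → j < x → column (x ∷ xs) j ≡ suc (column xs j)
column-∷-> {j = j} j<x = cong length (filter-accept (j <?_) j<x)

column-∷-≤ : ∀ {x xs j} → x ≤ j → column (x ∷ xs) j ≡ column xs j
column-∷-≤ {j = j} x≤j = cong length (filter-reject (j <?_) (≤⇒≯ x≤j))

column-∷-≤-suc : ∀ x xs j → column (x ∷ xs) j ≤ suc (column xs j)
column-∷-≤-suc x xs j with x ≤? j
... | yes x≤j = ≤-trans (≤-reflexive (column-∷-≤ x≤j)) (n≤1+n _)
... | no x≰j = ≤-reflexive (column-∷-> (≰⇒> x≰j))

part≤⇒column≤ : ∀ {L i j} → Decreasing L → part L i ≤ j → column L j ≤ i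
part≤⇒column≤ {[]} _ _ = z≤n
part≤⇒column≤ {x ∷ xs} {zero} d x≤j = begin
  column (x ∷ xs) _ ≡⟨ column-∷-≤ x≤j ⟩
  column xs _       ≤⟨ part≤⇒column≤ {xs} {zero} (Linked.tail d) (≤-trans (part-≤-head d 1) x≤j) ⟩
  zero              ∎
  where open ≤-Reasoning
part≤⇒column≤ {x ∷ xs} {suc i} {j} d xsᵢ≤j =
  ≤-trans (column-∷-≤-suc x xs j) (s≤s (part≤⇒column≤ (Linked.tail d) xsᵢ≤j))

column≤⇒part≤ : ∀ {L i j} → Decreasing L → column L j ≤ i → part L i ≤ j
column≤⇒part≤ {[]} _ _ = z≤n
column≤⇒part≤ {x ∷ xs} {i} {j} d c≤i with x ≤? j
... | yes x≤j = ≤-trans (part-≤-head d i) x≤j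
column≤⇒part≤ {x ∷ xs} {zero} d c≤0 | no x≰j =
  contradiction (subst (_≤ 0) (column-∷-> (≰⇒> x≰j)) c≤0) λ ()
column≤⇒part≤ {x ∷ xs} {suc i} d c≤1+i | no x≰j =
  column≤⇒part≤ (Linked.tail d) (≤-pred (subst (_≤ suc i) (column-∷-> (≰⇒> x≰j)) c≤1+i))

RowBound : ℕ → ℕ → List ℕ → List ℕ → Set
RowBound s c A B = ∀ i → part A (s + i) ≤ c + part B i

ColumnBound : ℕ → ℕ → List ℕ → List ℕ → Set
ColumnBound s c A B = ∀ j → column A (c + j) ≤ s + column B j

rowBound⇒columnBound : ∀ {s c A B} → Decreasing A → Decreasing B →
                       RowBound s c A B → ColumnBound s c A B
rowBound⇒columnBound {s} {c} {A} {B} dA dB b j = part≤⇒column≤ dA (begin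
  part A (s + column B j) ≤⟨ b (column B j) ⟩
  c + part B (column B j) ≤⟨ +-monoʳ-≤ c (column≤⇒part≤ dB ≤-refl) ⟩
  c + j                   ∎)
  where open ≤-Reasoning

columnBound⇒rowBound : ∀ {s c A B} → Decreasing A → Decreasing B →
                       ColumnBound s c A B → RowBound s c A B
columnBound⇒rowBound {s} {c} {A} {B} dA dB b i = column≤⇒part≤ dA (begin
  column A (c + part B i) ≤⟨ b (part B i) ⟩
  s + column B (part B i) ≤⟨ +-monoʳ-≤ s (part≤⇒column≤ dB ≤-refl) ⟩
  s + i                   ∎)
  where open ≤-Reasoning

columnBound-merge : ∀ {s c μ α ν β} → ColumnBound s c μ α → ColumnBound s c ν β →
                    ColumnBound (s + s) c (merge μ ν) (merge α β)
columnBound-merge {s} {c} {μ} {α} {ν} {β} bμ bν j = begin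
  column (merge μ ν) (c + j)              ≡⟨ column-merge μ ν (c + j) ⟩
  column μ (c + j) + column ν (c + j)     ≤⟨ +-mono-≤ (bμ j) (bν j) ⟩
  (s + column α j) + (s + column β j)     ≡⟨ interchange s (column α j) s (column β j) ⟩
  (s + s) + (column α j + column β j)     ≡⟨ cong (s + s +_) (column-merge α β j) ⟨
  (s + s) + column (merge α β) j          ∎
  where open ≤-Reasoning

evens odds : List ℕ → List ℕ
evens = proj₁ ∘ split
odds = proj₂ ∘ split

part-evens : ∀ L i → part (evens L) i ≡ part L (i + i)
part-odds : ∀ L i → part (odds L) i ≡ part L (suc (i + i))
part-evens [] i = refl
part-evens (x ∷ xs) zero = refl
part-evens (x ∷ xs) (suc i) = trans (part-odds xs i) (cong (part xs) (sym (+-suc i i)))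
part-odds [] i = refl
part-odds (x ∷ xs) i = part-evens xs i

evens-antitone : ∀ {L} → part L Preserves _≤_ ⟶ _≥_ → part (evens L) Preserves _≤_ ⟶ _≥_
evens-antitone {L} a {i} {j} i≤j =
  subst₂ _≥_ (sym (part-evens L i)) (sym (part-evens L j)) (a (+-mono-≤ i≤j i≤j))

odds-antitone : ∀ {L} → part L Preserves _≤_ ⟶ _≥_ → part (odds L) Preserves _≤_ ⟶ _≥_
odds-antitone {L} a {i} {j} i≤j =
  subst₂ _≥_ (sym (part-odds L i)) (sym (part-odds L j)) (a (s≤s (+-mono-≤ i≤j i≤j)))

rowBound-split : ∀ {s c M N} → RowBound (s + s) c M N →
                 RowBound s c (evens M) (evens N) × RowBound s c (odds M) (odds N)
rowBound-split {s} {c} {M} {N} b = evens-bound , odds-bound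
  where
  open ≤-Reasoning
  evens-bound : RowBound s c (evens M) (evens N)
  evens-bound i = begin
    part (evens M) (s + i)     ≡⟨ part-evens M (s + i) ⟩
    part M ((s + i) + (s + i)) ≡⟨ cong (part M) (interchange s i s i) ⟩
    part M ((s + s) + (i + i)) ≤⟨ b (i + i) ⟩
    c + part N (i + i)         ≡⟨ cong (c +_) (part-evens N i) ⟨
    c + part (evens N) i       ∎
  odds-bound : RowBound s c (odds M) (odds N)
  odds-bound i = begin
    part (odds M) (s + i)            ≡⟨ part-odds M (s + i) ⟩
    part M (suc ((s + i) + (s + i))) ≡⟨ cong (part M ∘ suc) (interchange s i s i) ⟩
    part M (suc ((s + s) + (i + i))) ≡⟨ cong (part M) (+-suc (s + s) (i + i)) ⟨
    part M ((s + s) + suc (i + i))   ≤⟨ b (suc (i + i)) ⟩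
    c + part N (suc (i + i))         ≡⟨ cong (c +_) (part-odds N i) ⟨
    c + part (odds N) i              ∎

rowBound-tilde : ∀ {s c μ α ν β} → Decreasing μ → Decreasing α → Decreasing ν → Decreasing β →
                 RowBound s c μ α → RowBound s c ν β →
                 RowBound s c (proj₁ (tilde μ ν)) (proj₁ (tilde α β)) ×
                 RowBound s c (proj₂ (tilde μ ν)) (proj₂ (tilde α β))
rowBound-tilde {s} {c} {μ} {α} {ν} {β} dμ dα dν dβ bμ bν =
  rowBound-split {M = merge μ ν} {merge α β} merged-bound
  where
  merged-bound : RowBound (s + s) c (merge μ ν) (merge α β)
  merged-bound =
    columnBound⇒rowBound (merge-decreasing dμ dν) (merge-decreasing dα dβ)
      (columnBound-merge {μ = μ} {α} {ν} {β}
        (rowBound⇒columnBound dμ dα bμ) (rowBound⇒columnBound dν dβ bν))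

tilde-⊆ : ∀ {μ α ν β} → Decreasing μ → Decreasing α → Decreasing ν → Decreasing β →
          α ⊆ᵖ μ → β ⊆ᵖ ν →
          proj₁ (tilde α β) ⊆ᵖ proj₁ (tilde μ ν) × proj₂ (tilde α β) ⊆ᵖ proj₂ (tilde μ ν)
tilde-⊆ dμ dα dν dβ = rowBound-tilde {s = 0} {c = 0} dα dμ dβ dν

tilde-antitone : ∀ {μ ν} → Decreasing μ → Decreasing ν →
                 part (proj₁ (tilde μ ν)) Preserves _≤_ ⟶ _≥_ ×
                 part (proj₂ (tilde μ ν)) Preserves _≤_ ⟶ _≥_
tilde-antitone {μ} {ν} dμ dν =
  evens-antitone {merge μ ν} (part-antitone (merge-decreasing dμ dν)) ,
  odds-antitone {merge μ ν} (part-antitone (merge-decreasing dμ dν))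

DefinedByRowBound : ℕ → ℕ → (List ℕ → List ℕ → Set) → Set
DefinedByRowBound s c P =
  ∀ μ α → part μ Preserves _≤_ ⟶ _≥_ → part α Preserves _≤_ ⟶ _≥_ →
  P μ α ⇔ (α ⊆ᵖ μ × RowBound s c μ α)

rowBound-shape-preservedByTilde : ∀ s c {P} → DefinedByRowBound s c P → PreservedByTilde P
rowBound-shape-preservedByTilde _ _ P⇔ μ α ν β (dμ , _) (dα , _) (dν , _) (dβ , _) Pμα Pνβ
  =
  let α⊆μ , bμ = Equivalence.to (P⇔ μ α (part-antitone dμ) (part-antitone dα)) Pμα
      β⊆ν , bν = Equivalence.to (P⇔ ν β (part-antitone dν) (part-antitone dβ)) Pνβ
      σ⊆λ , τ⊆ρ = tilde-⊆ dμ dα dν dβ α⊆μ β⊆ν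
      bλ , bρ = rowBound-tilde dμ dα dν dβ bμ bν
      aλ , aρ = tilde-antitone dμ dν
      aσ , aτ = tilde-antitone dα dβ
  in Equivalence.from (P⇔ _ _ aλ aσ) (σ⊆λ , bλ) , Equivalence.from (P⇔ _ _ aρ aτ) (τ⊆ρ , bρ)

horizontalStrip⇔rowBound : DefinedByRowBound 1 0 IsHorizontalStrip
horizontalStrip⇔rowBound μ α aμ aα =
  mk⇔ (λ (α⊆μ , h) → α⊆μ , bound h) (λ (α⊆μ , b) → α⊆μ , one-cell-per-column b)
  where
  bound : (∀ i i' j → i < i' → ¬ (InSkew μ α i j × InSkew μ α i' j)) → RowBound 1 0 μ α
  bound h i with part μ (suc i) ≤? part α i
  ... | yes μ≤α = μ≤α
  ... | no μ≰α = contradiction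
    -- column α_i would meet rows i and i + 1
    ((≤-refl , <-≤-trans (≰⇒> μ≰α) (aμ (n≤1+n i))) , (aα (n≤1+n i) , ≰⇒> μ≰α))
    (h i (suc i) (part α i) (n<1+n i))
  one-cell-per-column : RowBound 1 0 μ α →
                        ∀ i i' j → i < i' → ¬ (InSkew μ α i j × InSkew μ α i' j)
  one-cell-per-column b i i' j i<i' ((αᵢ≤j , _) , (_ , j<μᵢ')) =
    <⇒≱ j<μᵢ' (≤-trans (aμ i<i') (≤-trans (b i) αᵢ≤j))

verticalStrip⇔rowBound : DefinedByRowBound 0 1 IsVerticalStrip
verticalStrip⇔rowBound μ α _ _ =
  mk⇔ (λ (α⊆μ , h) → α⊆μ , bound h) (λ (α⊆μ , b) → α⊆μ , one-cell-per-row b)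
  where
  bound : (∀ i j j' → j < j' → ¬ (InSkew μ α i j × InSkew μ α i j')) → RowBound 0 1 μ α
  bound h i with part μ i ≤? suc (part α i)
  ... | yes μ≤α = μ≤α
  ... | no μ≰α = contradiction
    -- row i would contain the cells in columns α_i and α_i + 1
    ((≤-refl , <-trans (n<1+n _) (≰⇒> μ≰α)) , (n≤1+n _ , ≰⇒> μ≰α))
    (h i (part α i) (suc (part α i)) (n<1+n _))
  one-cell-per-row : RowBound 0 1 μ α →
                     ∀ i j j' → j < j' → ¬ (InSkew μ α i j × InSkew μ α i j')
  one-cell-per-row b i j j' j<j' ((αᵢ≤j , _) , (_ , j'<μᵢ)) =
    <⇒≱ j<j' (≤-pred (≤-trans j'<μᵢ (≤-trans (b i) (s≤s αᵢ≤j))))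

weakRibbon⇔rowBound : DefinedByRowBound 1 1 IsWeakRibbon
weakRibbon⇔rowBound μ α aμ aα =
  mk⇔ (λ (α⊆μ , h) → α⊆μ , bound h) (λ (α⊆μ , b) → α⊆μ , no-square b)
  where
  Square : ℕ → ℕ → Set
  Square i j = InSkew μ α i j × InSkew μ α (suc i) j
             × InSkew μ α i (suc j) × InSkew μ α (suc i) (suc j)
  bound : (∀ i j → ¬ Square i j) → RowBound 1 1 μ α
  bound h i with part μ (suc i) ≤? suc (part α i)
  ... | yes μ≤α = μ≤α
  ... | no μ≰α = contradiction
    -- the square with corner (i, α_i) would lie in μ/α
    ( (≤-refl , <-trans (n<1+n _) below-μᵢ)
    , (aα (n≤1+n i) , <-trans (n<1+n _) (≰⇒> μ≰α))
    , (n≤1+n _ , below-μᵢ)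
    , (≤-trans (aα (n≤1+n i)) (n≤1+n _) , ≰⇒> μ≰α))
    (h i (part α i))
    where
    below-μᵢ : suc (part α i) < part μ i
    below-μᵢ = <-≤-trans (≰⇒> μ≰α) (aμ (n≤1+n i))
  no-square : RowBound 1 1 μ α → ∀ i j → ¬ Square i j
  no-square b i j ((αᵢ≤j , _) , _ , _ , (_ , j+1<μᵢ₊₁)) =
    <-irrefl refl (≤-trans j+1<μᵢ₊₁ (≤-trans (b i) (s≤s αᵢ≤j)))

ones : ℕ → List ℕ
ones k = replicate k 1

merge-ones : ∀ k l → merge (ones k) (ones l) ≡ ones (k + l)
merge-ones zero l = refl
merge-ones (suc k) zero = cong ones (sym (+-identityʳ (suc k)))
merge-ones (suc k) (suc l) = cong (1 ∷_) (merge-ones k (suc l))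

merge-ones-hook : ∀ k l {b} → 1 ≤ b → merge (ones k) (b ∷ ones l) ≡ b ∷ ones (k + l)
merge-ones-hook zero l _ = refl
merge-ones-hook (suc k) l {suc zero} _ = cong (1 ∷_) (merge-ones-hook k l (s≤s z≤n))
merge-ones-hook (suc k) l {suc (suc b)} _ = cong (suc (suc b) ∷_) (merge-ones (suc k) l)

merge-hook-ones : ∀ k l {a} → 1 ≤ a → merge (a ∷ ones k) (ones l) ≡ a ∷ ones (k + l)
merge-hook-ones k zero {a} _ = cong (λ n → a ∷ ones n) (sym (+-identityʳ k))
merge-hook-ones k (suc l) {suc a} _ = cong (suc a ∷_) (merge-ones k (suc l))

merge-hooks : ∀ k l {a b} → 1 ≤ a → 1 ≤ b →
              ∃₂ λ x y → 1 ≤ x × 1 ≤ y × merge (a ∷ ones k) (b ∷ ones l) ≡ x ∷ y ∷ ones (k + l)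
merge-hooks k l {a} {b} 1≤a 1≤b with b ≤ᵇ a
... | true = a , b , 1≤a , 1≤b , cong (a ∷_) (merge-ones-hook k l 1≤b)
... | false = b , a , 1≤b , 1≤a , cong (b ∷_) (merge-hook-ones k l 1≤a)

split-ones : ∀ n → ∃₂ λ p q → split (ones n) ≡ (ones p , ones q)
split-ones zero = 0 , 0 , refl
split-ones (suc n) with split-ones n
... | p , q , split≡ = suc q , p , cong (λ (evs , ods) → 1 ∷ ods , evs) split≡

tilde-hooks : ∀ {μ ν} → IsHook μ → IsHook ν → IsHook (proj₁ (tilde μ ν)) × IsHook (proj₂ (tilde μ ν))
tilde-hooks (a , k , 1≤a , refl) (b , l , 1≤b , refl)
  with merge-hooks k l 1≤a 1≤b | split-ones (k + l)
... | x , y , 1≤x , 1≤y , merge≡ | p , q , split≡ rewrite merge≡ | split≡ =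
  (x , p , 1≤x , refl) , (y , q , 1≤y , refl)

skewedHook-preservedByTilde : PreservedByTilde IsSkewedHook
skewedHook-preservedByTilde μ α ν β (dμ , _) (dα , _) (dν , _) (dβ , _) (α⊆μ , hμ , hα) (β⊆ν , hν , hβ) =
  let σ⊆λ , τ⊆ρ = tilde-⊆ dμ dα dν dβ α⊆μ β⊆ν
      hλ , hρ = tilde-hooks hμ hν
      hσ , hτ = tilde-hooks hα hβ
  in (σ⊆λ , hλ , hσ) , (τ⊆ρ , hρ , hτ)

proposition5p3 : PreservedByTilde IsHorizontalStrip
               × PreservedByTilde IsVerticalStrip
               × PreservedByTilde IsWeakRibbon
               × PreservedByTilde IsSkewedHook
proposition5p3 = rowBound-shape-preservedByTilde 1 0 horizontalStrip⇔rowBound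
               , rowBound-shape-preservedByTilde 0 1 verticalStrip⇔rowBound
               , rowBound-shape-preservedByTilde 1 1 weakRibbon⇔rowBound
               , skewedHook-preservedByTilde
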